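{- Let $u_0\geq 1$ and $r\geq 2$ be integers with $\gcd(u_0,r)=1$, let $n\geq 0$ be an integer, and set $u_j:=u_0+jr$ for $0\leq j\leq n$ and $L_n:=\operatorname{lcm}(u_0,u_1,\ldots,u_n)$. Then for every integer $k$ with $0\leq k\leq n$, $$L_n \geq \frac{u_k u_{k+1}\cdots u_n}{(n-k)!}\left(\frac{r^{(n-k)/(r-1)}}{n-k+1}\right).$$ -}

module Defs where

open import Data.Nat.Base using (ℕ; zero; suc; _+_; _*_)
open import Data.Nat.LCM using (lcm)

u : ℕ → ℕ → ℕ → ℕ
u u0 r j = u0 + j * r

L : ℕ → ℕ → ℕ → ℕ
L u0 r zero    = u u0 r zero
L u0 r (suc n) = lcm (L u0 r n) (u u0 r (suc n))

-- product u_k u_{k+1} ... u_{k+m}  (m+1 factors)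
prodFrom : ℕ → ℕ → ℕ → ℕ → ℕ
prodFrom u0 r k zero    = u u0 r k
prodFrom u0 r k (suc m) = prodFrom u0 r k m * u u0 r (k + suc m)

module Submission where

-- With m = n − k and P = u_k ⋯ u_n: every u_j divides L, and a product of m + 1 consecutive
-- terms of an arithmetic progression whose terms all divide L divides L · m! · rᵐ. As P is
-- coprime to r while r^ν divides m! for Legendre's sum ν = ⌊m/r⌋ + ⌊m/r²⌋ + ⋯, this sharpens
-- to P · r^ν ≤ L · m!. Finally rᵐ ≤ (r^ν · (m + 1))^(r − 1), since m − (r − 1)ν is the base-r
-- digit sum of m and r^t ≤ (t + 1)^(r − 1) for every digit t.

open import Defs
open import Data.Nat.Base using (ℕ; zero; suc; _+_; _*_; _∸_; _^_; _≤_; _!; z≤n; s≤s; NonZero; >-nonZero; z<s; >-nonZero⁻¹; _/_; _%_)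
open import Data.Nat.GCD using (gcd)
open import Data.Nat.Properties
open import Data.Nat.Divisibility
open import Data.Nat.DivMod using (m≡m%n+[m/n]*n; m%n<n; m/n<m; m/n*n≤m)
open import Data.Nat.LCM using (m∣lcm[m,n]; n∣lcm[m,n]; gcd*lcm)
open import Data.Nat.Coprimality using (Coprime; coprime-+; coprime-divisor; gcd≡1⇒coprime)
  renaming (sym to coprime-sym)
open import Data.Product using (_,_)
open import Data.Sum using (inj₁; inj₂)
open import Relation.Binary.PropositionalEquality using (_≡_; refl; sym; trans; cong; cong₂; subst; module ≡-Reasoning)
open import Data.Nat.Solver using (module +-*-Solver)
open +-*-Solver using (solve; _:+_; _:*_; _:=_; con)

^-distribʳ-* : ∀ m n o → (m * n) ^ o ≡ m ^ o * n ^ o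
^-distribʳ-* m n zero    = refl
^-distribʳ-* m n (suc o) rewrite ^-distribʳ-* m n o =
  solve 4 (λ m n x y → (m :* n) :* (x :* y) := (m :* x) :* (n :* y)) refl m n (m ^ o) (n ^ o)

[m^n]^o≡[m^o]^n : ∀ m n o → (m ^ n) ^ o ≡ (m ^ o) ^ n
[m^n]^o≡[m^o]^n m n o = begin
  (m ^ n) ^ o ≡⟨ ^-*-assoc m n o ⟩
  m ^ (n * o) ≡⟨ cong (m ^_) (*-comm n o) ⟩
  m ^ (o * n) ≡⟨ ^-*-assoc m o n ⟨
  (m ^ o) ^ n ∎
  where open ≡-Reasoning

^-cancelʳ-≤ : ∀ n .{{_ : NonZero n}} {m o} → m ^ n ≤ o ^ n → m ≤ o
^-cancelʳ-≤ n mⁿ≤oⁿ = ≮⇒≥ (λ o<m → <⇒≱ (^-monoˡ-< n o<m) mⁿ≤oⁿ)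

[1+n]^j≤[1+j]*n^j : ∀ n j → j ≤ n → suc n ^ j ≤ suc j * n ^ j
[1+n]^j≤[1+j]*n^j n zero    _   = ≤-refl
[1+n]^j≤[1+j]*n^j n (suc j) j<n = begin
  suc n * suc n ^ j                   ≤⟨ *-monoʳ-≤ (suc n) ([1+n]^j≤[1+j]*n^j n j (<⇒≤ j<n)) ⟩
  suc n * (suc j * n ^ j)             ≡⟨ solve 3 (λ n j x → (con 1 :+ n) :* ((con 1 :+ j) :* x)
                                               := (con 1 :+ j) :* (n :* x) :+ (con 1 :+ j) :* x) refl n j (n ^ j) ⟩
  suc j * (n * n ^ j) + suc j * n ^ j ≤⟨ +-monoʳ-≤ (suc j * (n * n ^ j)) (*-monoˡ-≤ (n ^ j) j<n) ⟩
  suc j * (n * n ^ j) + n * n ^ j     ≡⟨ +-comm (suc j * (n * n ^ j)) (n * n ^ j) ⟩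
  suc (suc j) * (n * n ^ j)           ∎
  where open ≤-Reasoning

[2+n]^n≤[1+n]^[1+n] : ∀ n → suc (suc n) ^ n ≤ suc n ^ suc n
[2+n]^n≤[1+n]^[1+n] n = *-cancelˡ-≤ (suc (suc n)) ([1+n]^j≤[1+j]*n^j (suc n) (suc n) ≤-refl)

-- Equivalently n ↦ n^(1/(n−1)) is decreasing; the previous lemma is its one-step case.
[1+c]^t≤[1+t]^c : ∀ {t c} → t ≤ c → suc c ^ t ≤ suc t ^ c
[1+c]^t≤[1+t]^c {zero}  {c}     _         = m^n>0 1 c
[1+c]^t≤[1+t]^c {suc t} {suc c} (s≤s t≤c) with m≤n⇒m<n∨m≡n t≤c
... | inj₂ refl = ≤-refl
... | inj₁ t<c  = ^-cancelʳ-≤ c {{>-nonZero (<-≤-trans z<s t<c)}} (begin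
  (suc (suc c) ^ suc t) ^ c     ≡⟨ [m^n]^o≡[m^o]^n (suc (suc c)) (suc t) c ⟩
  (suc (suc c) ^ c) ^ suc t     ≤⟨ ^-monoˡ-≤ (suc t) ([2+n]^n≤[1+n]^[1+n] c) ⟩
  (suc c ^ suc c) ^ suc t       ≡⟨ [m^n]^o≡[m^o]^n (suc c) (suc c) (suc t) ⟩
  (suc c ^ suc t) ^ suc c       ≤⟨ ^-monoˡ-≤ (suc c) ([1+c]^t≤[1+t]^c t<c) ⟩
  (suc (suc t) ^ c) ^ suc c     ≡⟨ [m^n]^o≡[m^o]^n (suc (suc t)) c (suc c) ⟩
  (suc (suc t) ^ suc c) ^ c     ∎)
  where open ≤-Reasoning

[1+q]^c*[1+c]^t≤[1+t+q*[1+c]]^c : ∀ c q {t} → t ≤ c → suc q ^ c * suc c ^ t ≤ suc (t + q * suc c) ^ c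
[1+q]^c*[1+c]^t≤[1+t+q*[1+c]]^c c q {t} t≤c = begin
  suc q ^ c * suc c ^ t ≤⟨ *-monoʳ-≤ (suc q ^ c) ([1+c]^t≤[1+t]^c t≤c) ⟩
  suc q ^ c * suc t ^ c ≡⟨ ^-distribʳ-* (suc q) (suc t) c ⟨
  (suc q * suc t) ^ c   ≤⟨ ^-monoˡ-≤ c (+-monoʳ-≤ (suc t) (*-monoʳ-≤ q (s≤s t≤c))) ⟩
  suc (t + q * suc c) ^ c ∎
  where open ≤-Reasoning

-- Legendre's sum ⌊m/r⌋ + ⌊m/r²⌋ + ⋯ for r = 1 + c, truncated after f terms; no nonzero term
-- is lost once f ≥ m.
ν : ℕ → ℕ → ℕ → ℕ
ν c zero    m = 0
ν c (suc f) m = m / suc c + ν c f (m / suc c)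

m≤1+f⇒m/[1+c]≤f : ∀ c .{{_ : NonZero c}} {m f} → m ≤ suc f → m / suc c ≤ f
m≤1+f⇒m/[1+c]≤f c {zero}  _         = z≤n
m≤1+f⇒m/[1+c]≤f c {suc m} (s≤s m≤f) =
  ≤-trans (≤-pred (m/n<m (suc m) (suc c) (s≤s (>-nonZero⁻¹ c)))) m≤f

-- In base r = 1 + c this says r^(digit sum of m) ≤ (1 + m)^c; the step peels off the last digit t.
[1+c]^m≤[[1+c]^ν*[1+m]]^c : ∀ c .{{_ : NonZero c}} f {m} → m ≤ f → suc c ^ m ≤ (suc c ^ ν c f m * suc m) ^ c
[1+c]^m≤[[1+c]^ν*[1+m]]^c c zero    {zero} _   = m^n>0 1 c
[1+c]^m≤[[1+c]^ν*[1+m]]^c c (suc f) {m}    m≤f =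
  subst (λ x → r ^ x ≤ (r ^ (q + ν c f q) * suc x) ^ c) (sym m≡t+q*r)
    (step ([1+c]^m≤[[1+c]^ν*[1+m]]^c c f (m≤1+f⇒m/[1+c]≤f c m≤f)))
  where
  r = suc c
  q = m / r
  t = m % r
  e = ν c f q
  m≡t+q*r : m ≡ t + q * r
  m≡t+q*r = m≡m%n+[m/n]*n m r
  t≤c : t ≤ c
  t≤c = ≤-pred (m%n<n m r)
  step : r ^ q ≤ (r ^ e * suc q) ^ c → r ^ (t + q * r) ≤ (r ^ (q + e) * suc (t + q * r)) ^ c
  step ih = begin
    r ^ (t + q * r)                          ≡⟨ ^-distribˡ-+-* r t (q * r) ⟩
    r ^ t * r ^ (q * r)                      ≡⟨ cong (r ^ t *_) (^-*-assoc r q r) ⟨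
    r ^ t * (r ^ q * (r ^ q) ^ c)            ≤⟨ *-monoʳ-≤ (r ^ t) (*-monoˡ-≤ ((r ^ q) ^ c) ih) ⟩
    r ^ t * ((r ^ e * suc q) ^ c * (r ^ q) ^ c)
      ≡⟨ cong (λ z → r ^ t * (z * (r ^ q) ^ c)) (^-distribʳ-* (r ^ e) (suc q) c) ⟩
    r ^ t * ((r ^ e) ^ c * suc q ^ c * (r ^ q) ^ c)
      ≡⟨ solve 4 (λ T E Q X → T :* ((E :* Q) :* X) := (X :* E) :* (Q :* T)) refl
           (r ^ t) ((r ^ e) ^ c) (suc q ^ c) ((r ^ q) ^ c) ⟩
    (r ^ q) ^ c * (r ^ e) ^ c * (suc q ^ c * r ^ t)
      ≤⟨ *-monoʳ-≤ ((r ^ q) ^ c * (r ^ e) ^ c) ([1+q]^c*[1+c]^t≤[1+t+q*[1+c]]^c c q t≤c) ⟩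
    (r ^ q) ^ c * (r ^ e) ^ c * suc (t + q * r) ^ c
      ≡⟨ cong (_* suc (t + q * r) ^ c) (^-distribʳ-* (r ^ q) (r ^ e) c) ⟨
    (r ^ q * r ^ e) ^ c * suc (t + q * r) ^ c ≡⟨ ^-distribʳ-* (r ^ q * r ^ e) (suc (t + q * r)) c ⟨
    (r ^ q * r ^ e * suc (t + q * r)) ^ c    ≡⟨ cong (λ z → (z * suc (t + q * r)) ^ c) (^-distribˡ-+-* r q e) ⟨
    (r ^ (q + e) * suc (t + q * r)) ^ c      ∎
    where open ≤-Reasoning

[1+c]^q*q!∣[[1+c]*q]! : ∀ c q → suc c ^ q * q ! ∣ (suc c * q) !
[1+c]^q*q!∣[[1+c]*q]! c zero    rewrite *-zeroʳ c = ∣-refl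
[1+c]^q*q!∣[[1+c]*q]! c (suc q) = begin
  r ^ suc q * suc q !           ≡⟨ solve 4 (λ c q X Y → ((con 1 :+ c) :* X) :* ((con 1 :+ q) :* Y)
                                     := (X :* Y) :* ((con 1 :+ c) :* (con 1 :+ q))) refl c q (r ^ q) (q !) ⟩
  (r ^ q * q !) * (r * suc q)   ∣⟨ *-pres-∣ (∣-trans ([1+c]^q*q!∣[[1+c]*q]! c q) (m≤n⇒m!∣n! (m≤n+m (r * q) c)))
                                            (∣-reflexive (*-suc r q)) ⟩
  (c + r * q) ! * suc (c + r * q) ≡⟨ *-comm ((c + r * q) !) (suc (c + r * q)) ⟩
  suc (c + r * q) !             ≡⟨ cong _! (*-suc r q) ⟨
  (r * suc q) !                 ∎
  where
  open ∣-Reasoning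
  r = suc c

[1+c]^ν∣m! : ∀ c f m → suc c ^ ν c f m ∣ m !
[1+c]^ν∣m! c zero    m = 1∣ (m !)
[1+c]^ν∣m! c (suc f) m = begin
  r ^ (q + ν c f q)   ≡⟨ ^-distribˡ-+-* r q (ν c f q) ⟩
  r ^ q * r ^ ν c f q ∣⟨ *-monoʳ-∣ (r ^ q) ([1+c]^ν∣m! c f q) ⟩
  r ^ q * q !         ∣⟨ [1+c]^q*q!∣[[1+c]*q]! c q ⟩
  (r * q) !           ∣⟨ m≤n⇒m!∣n! (subst (_≤ m) (*-comm q r) (m/n*n≤m m r)) ⟩
  m !                 ∎
  where
  open ∣-Reasoning
  r = suc c
  q = m / r

prodFrom-unfoldˡ : ∀ u0 r k m → prodFrom u0 r k (suc m) ≡ u u0 r k * prodFrom u0 r (suc k) m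
prodFrom-unfoldˡ u0 r k zero    = cong (λ j → u u0 r k * u u0 r j) (+-comm k 1)
prodFrom-unfoldˡ u0 r k (suc m) = begin
  prodFrom u0 r k (suc m) * u u0 r (k + suc (suc m))
    ≡⟨ cong₂ _*_ (prodFrom-unfoldˡ u0 r k m) (cong (u u0 r) (+-suc k (suc m))) ⟩
  u u0 r k * prodFrom u0 r (suc k) m * u u0 r (suc k + suc m)
    ≡⟨ *-assoc (u u0 r k) (prodFrom u0 r (suc k) m) (u u0 r (suc k + suc m)) ⟩
  u u0 r k * (prodFrom u0 r (suc k) m * u u0 r (suc k + suc m)) ∎
  where open ≡-Reasoning

-- P(k, m+1) = P(k, m) · u_{k+m+1} = u_k · P(k+1, m), and both shorter products divide
-- N = M · m! · rᵐ; so P(k, m+1) divides N · u_{k+m+1} − u_k · N = N · (m+1) r.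
prodFrom∣M*m!*r^m : ∀ u0 r k m {M} → (∀ {i} → i ≤ m → u u0 r (k + i) ∣ M) →
                    prodFrom u0 r k m ∣ M * m ! * r ^ m
prodFrom∣M*m!*r^m u0 r k zero    {M} u∣M = begin
  u u0 r k       ≡⟨ cong (u u0 r) (+-identityʳ k) ⟨
  u u0 r (k + 0) ∣⟨ u∣M z≤n ⟩
  M              ≡⟨ trans (*-identityʳ (M * 1)) (*-identityʳ M) ⟨
  M * 1 * 1      ∎
  where open ∣-Reasoning
prodFrom∣M*m!*r^m u0 r k (suc m) {M} u∣M = ∣-trans (∣m+n∣m⇒∣n P∣N*u[k]+N*[1+m]*r P∣u[k]*N) (∣-reflexive N*[1+m]*r≡)
  where
  P = prodFrom u0 r k (suc m)
  N = M * m ! * r ^ m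
  P∣N*u[k]+N*[1+m]*r : P ∣ u u0 r k * N + N * (suc m * r)
  P∣N*u[k]+N*[1+m]*r = begin
    prodFrom u0 r k m * u u0 r (k + suc m)
      ∣⟨ *-pres-∣ (prodFrom∣M*m!*r^m u0 r k m (λ i≤m → u∣M (m≤n⇒m≤1+n i≤m))) ∣-refl ⟩
    N * (u0 + (k + suc m) * r)
      ≡⟨ solve 5 (λ N u0 k m r → N :* (u0 :+ (k :+ (con 1 :+ m)) :* r)
                   := (u0 :+ k :* r) :* N :+ N :* ((con 1 :+ m) :* r)) refl N u0 k m r ⟩
    u u0 r k * N + N * (suc m * r) ∎
    where open ∣-Reasoning
  P∣u[k]*N : P ∣ u u0 r k * N
  P∣u[k]*N = begin
    P                                    ≡⟨ prodFrom-unfoldˡ u0 r k m ⟩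
    u u0 r k * prodFrom u0 r (suc k) m   ∣⟨ *-monoʳ-∣ (u u0 r k) (prodFrom∣M*m!*r^m u0 r (suc k) m
                                              (λ {i} i≤m → subst (_∣ M) (cong (u u0 r) (+-suc k i)) (u∣M (s≤s i≤m)))) ⟩
    u u0 r k * N                         ∎
    where open ∣-Reasoning
  N*[1+m]*r≡ : N * (suc m * r) ≡ M * suc m ! * r ^ suc m
  N*[1+m]*r≡ = solve 5 (λ M F R r m → (M :* F :* R) :* ((con 1 :+ m) :* r)
                         := M :* ((con 1 :+ m) :* F) :* (r :* R)) refl M (m !) (r ^ m) r m

coprime-*ˡ : ∀ {x y z} → Coprime x z → Coprime y z → Coprime (x * y) z
coprime-*ˡ {x} {y} {z} x⊥z y⊥z {d} (d∣xy , d∣z) = y⊥z (coprime-divisor d⊥x d∣xy , d∣z)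
  where
  d⊥x : Coprime d x
  d⊥x (e∣d , e∣x) = x⊥z (e∣x , ∣-trans e∣d d∣z)

coprime-^ʳ : ∀ {x z} → Coprime x z → ∀ e → Coprime x (z ^ e)
coprime-^ʳ x⊥z zero    (_ , d∣1) = ∣1⇒≡1 d∣1
coprime-^ʳ x⊥z (suc e) = coprime-sym (coprime-*ˡ (coprime-sym x⊥z) (coprime-sym (coprime-^ʳ x⊥z e)))

u-coprime : ∀ {u0 r} → Coprime u0 r → ∀ j → Coprime (u u0 r j) r
u-coprime {u0}     u0⊥r zero    = subst (λ z → Coprime z _) (sym (+-identityʳ u0)) u0⊥r
u-coprime {u0} {r} u0⊥r (suc j) = subst (λ z → Coprime z r)
  (solve 3 (λ u0 r j → r :+ (u0 :+ j :* r) := u0 :+ (con 1 :+ j) :* r) refl u0 r j) (coprime-+ (u-coprime u0⊥r j))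

prodFrom-coprime : ∀ {u0 r} → Coprime u0 r → ∀ k m → Coprime (prodFrom u0 r k m) r
prodFrom-coprime u0⊥r k zero    = u-coprime u0⊥r k
prodFrom-coprime u0⊥r k (suc m) = coprime-*ˡ (prodFrom-coprime u0⊥r k m) (u-coprime u0⊥r (k + suc m))

u∣L : ∀ u0 r {j n} → j ≤ n → u u0 r j ∣ L u0 r n
u∣L u0 r {zero}  {zero}  z≤n  = ∣-refl
u∣L u0 r {j}     {suc n} j≤1+n with m≤n⇒m<n∨m≡n j≤1+n
... | inj₁ (s≤s j≤n) = ∣-trans (u∣L u0 r j≤n) (m∣lcm[m,n] (L u0 r n) (u u0 r (suc n)))
... | inj₂ refl      = n∣lcm[m,n] (L u0 r n) (u u0 r (suc n))

u≢0 : ∀ u0 r j .{{_ : NonZero u0}} → NonZero (u u0 r j)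
u≢0 u0 r j = >-nonZero (≤-trans (>-nonZero⁻¹ u0) (m≤m+n u0 (j * r)))

L≢0 : ∀ u0 r n .{{_ : NonZero u0}} → NonZero (L u0 r n)
L≢0 u0 r zero    = u≢0 u0 r 0
L≢0 u0 r (suc n) = m*n≢0⇒n≢0 (gcd a b) {{subst NonZero (sym (gcd*lcm a b)) (m*n≢0 a b {{L≢0 u0 r n}} {{u≢0 u0 r (suc n)}})}}
  where
  a = L u0 r n
  b = u u0 r (suc n)

coprime-∣⇒*≤ : ∀ {p m x y z} .{{_ : NonZero m}} .{{_ : NonZero x}} →
               Coprime p (y * z) → y ∣ x → p ∣ m * x * z → p * y ≤ m * x
coprime-∣⇒*≤ {p} {m} {x} {y} {z} {{_}} {{x≢0}} p⊥yz (divides q x≡q*y) p∣mxz = begin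
  p * y     ≤⟨ *-monoˡ-≤ y (∣⇒≤ {{m*n≢0 m q}} p∣mq) ⟩
  m * q * y ≡⟨ *-assoc m q y ⟩
  m * (q * y) ≡⟨ cong (m *_) x≡q*y ⟨
  m * x     ∎
  where
  open ≤-Reasoning
  instance
    q≢0 : NonZero q
    q≢0 = m*n≢0⇒m≢0 q {{subst NonZero x≡q*y x≢0}}
  p∣mq : p ∣ m * q
  p∣mq = coprime-divisor p⊥yz (subst (p ∣_) mxz≡yz*mq p∣mxz)
    where
    mxz≡yz*mq : m * x * z ≡ y * z * (m * q)
    mxz≡yz*mq = trans (cong (λ w → m * w * z) x≡q*y)
      (solve 4 (λ m q y z → m :* (q :* y) :* z := y :* z :* (m :* q)) refl m q y z)

theorem3p2 : (u0 r n k : ℕ) → 1 ≤ u0 → 2 ≤ r → gcd u0 r ≡ 1 → k ≤ n →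
    (prodFrom u0 r k (n ∸ k)) ^ (r ∸ 1) * r ^ (n ∸ k)
      ≤ (L u0 r n * (n ∸ k) ! * (n ∸ k + 1)) ^ (r ∸ 1)
theorem3p2 u0 (suc zero) n k _ (s≤s ()) _ _
theorem3p2 u0 r@(suc (suc c)) n k 1≤u0 _ gcd≡1 k≤n = begin
  P ^ suc c * r ^ m                    ≤⟨ *-monoʳ-≤ (P ^ suc c) ([1+c]^m≤[[1+c]^ν*[1+m]]^c (suc c) m ≤-refl) ⟩
  P ^ suc c * (r ^ e * suc m) ^ suc c  ≡⟨ ^-distribʳ-* P (r ^ e * suc m) (suc c) ⟨
  (P * (r ^ e * suc m)) ^ suc c        ≡⟨ cong (_^ suc c) (*-assoc P (r ^ e) (suc m)) ⟨
  (P * r ^ e * suc m) ^ suc c          ≤⟨ ^-monoˡ-≤ (suc c) (*-mono-≤ P*rᵉ≤L*m! (≤-reflexive (+-comm 1 m))) ⟩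
  (L u0 r n * m ! * (m + 1)) ^ suc c   ∎
  where
  open ≤-Reasoning
  m = n ∸ k
  P = prodFrom u0 r k m
  e = ν (suc c) m m
  instance
    u0≢0 : NonZero u0
    u0≢0 = >-nonZero 1≤u0
  P⊥rᵉ*rᵐ : Coprime P (r ^ e * r ^ m)
  P⊥rᵉ*rᵐ = subst (Coprime P) (^-distribˡ-+-* r e m)
    (coprime-^ʳ (prodFrom-coprime (gcd≡1⇒coprime gcd≡1) k m) (e + m))
  P∣L*m!*rᵐ : P ∣ L u0 r n * m ! * r ^ m
  P∣L*m!*rᵐ = prodFrom∣M*m!*r^m u0 r k m
    (λ i≤m → u∣L u0 r (≤-trans (+-monoʳ-≤ k i≤m) (≤-reflexive (m+[n∸m]≡n k≤n))))
  P*rᵉ≤L*m! : P * r ^ e ≤ L u0 r n * m !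
  P*rᵉ≤L*m! = coprime-∣⇒*≤ {{L≢0 u0 r n}} {{m !≢0}} P⊥rᵉ*rᵐ ([1+c]^ν∣m! (suc c) m m) P∣L*m!*rᵐ
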